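{- For every natural number $n$, the following rules are derivable in GŁ (and in GŁ$\forall$): ($\to\Rightarrow_{\frac1n}$) from $\mathcal{G}\mid\Gamma,B\Rightarrow_{\frac1n}A,\Delta\mid\Gamma\Rightarrow_{\frac1n}\Delta$ infer $\mathcal{G}\mid\Gamma,A\to B\Rightarrow_{\frac1n}\Delta$; ($\Rightarrow_{\frac1n}\to$) from $\mathcal{G}\mid\Gamma,A\Rightarrow_{\frac1n}B,\Delta$ and $\mathcal{G}\mid\Gamma\Rightarrow_{\frac1n}\Delta$ infer $\mathcal{G}\mid\Gamma\Rightarrow_{\frac1n}A\to B,\Delta$.
   Context: Sequents $\Gamma\Rightarrow\Delta$ are pairs of finite multisets of formulas; hypersequents are finite multisets of sequents written with $\mid$; $\mathcal{G}$ is an arbitrary side hypersequent. $n\Gamma$ is the multiset union of $n$ copies of $\Gamma$, and $\Gamma\Rightarrow_{\frac1n}\Delta$ denotes the sequent $\bot,n\Gamma\Rightarrow n\Delta$. A rule is derivable if its conclusion can be obtained from its premises using the rules of the calculus. GŁ has initial hypersequents $A\Rightarrow A$, $\Rightarrow$, $\bot\Rightarrow A$ and rules (ec) $\mathcal{G}\mid S\mid S\,/\,\mathcal{G}\mid S$; (ew) $\mathcal{G}\mid\Gamma\Rightarrow\Delta\,/\,\mathcal{G}\mid\Gamma\Rightarrow\Delta\mid\Gamma'\Rightarrow\Delta'$; (split) $\mathcal{G}\mid\Gamma_0,\Gamma_1\Rightarrow\Delta_0,\Delta_1\,/\,\mathcal{G}\mid\Gamma_0\Rightarrow\Delta_0\mid\Gamma_1\Rightarrow\Delta_1$;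 (mix) $\mathcal{G}\mid\Gamma_0\Rightarrow\Delta_0$ and $\mathcal{G}\mid\Gamma_1\Rightarrow\Delta_1\,/\,\mathcal{G}\mid\Gamma_0,\Gamma_1\Rightarrow\Delta_0,\Delta_1$; (wl) $\mathcal{G}\mid\Gamma\Rightarrow\Delta\,/\,\mathcal{G}\mid\Gamma,A\Rightarrow\Delta$; ($\to\Rightarrow$) $\mathcal{G}\mid\Gamma,B\Rightarrow A,\Delta\mid\Gamma\Rightarrow\Delta\,/\,\mathcal{G}\mid\Gamma,A\to B\Rightarrow\Delta$; ($\Rightarrow\to$) $\mathcal{G}\mid\Gamma,A\Rightarrow B,\Delta$ and $\mathcal{G}\mid\Gamma\Rightarrow\Delta\,/\,\mathcal{G}\mid\Gamma\Rightarrow A\to B,\Delta$. GŁ$\forall$ extends GŁ with quantifier rules for $\exists$. -}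

module Defs where

open import Data.Nat using (ℕ; zero; suc)
open import Data.List using (List; []; _∷_; _++_)
open import Data.List.Membership.Propositional using (_∈_)
open import Data.List.Relation.Binary.Permutation.Propositional using (_↭_)
open import Data.Product using (_×_; _,_)

data Fm (At : Set) : Set where
  var : At → Fm At
  ⊥'  : Fm At
  _⇒_ : Fm At → Fm At → Fm At

infixr 30 _⇒_

-- A sequent Γ ⇒ Δ: a pair of finite multisets, represented by lists
-- (order is made irrelevant by the exchange rules below).
record Seq (At : Set) : Set where
  constructor _⊢_
  field
    ante : List (Fm At)
    succ : List (Fm At)

infix 20 _⊢_

-- A hypersequent: finite multiset of sequents, represented as a list.
Hyp : Set → Set
Hyp At = List (Seq At)

-- Derivability in GŁ from a list of premises (hypotheses) P.
-- Multisets are modelled by lists plus exchange rules (permutation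
-- of the components of a hypersequent, and of the formulas in the
-- antecedent/succedent of the head sequent).
data GŁ {At : Set} (P : List (Hyp At)) : Hyp At → Set where
  hyp    : ∀ {H} → H ∈ P → GŁ P H
  exH    : ∀ {H H'} → H ↭ H' → GŁ P H → GŁ P H'
  exS    : ∀ {Γ Γ' Δ Δ' G} → Γ ↭ Γ' → Δ ↭ Δ' →
           GŁ P ((Γ ⊢ Δ) ∷ G) → GŁ P ((Γ' ⊢ Δ') ∷ G)
  id     : ∀ A → GŁ P (((A ∷ []) ⊢ (A ∷ [])) ∷ [])
  empty  : GŁ P (([] ⊢ []) ∷ [])
  ⊥l     : ∀ A → GŁ P (((⊥' ∷ []) ⊢ (A ∷ [])) ∷ [])
  ec     : ∀ {S G} → GŁ P (S ∷ S ∷ G) → GŁ P (S ∷ G)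
  ew     : ∀ {S S' G} → GŁ P (S ∷ G) → GŁ P (S ∷ S' ∷ G)
  split  : ∀ {Γ₀ Γ₁ Δ₀ Δ₁ G} →
           GŁ P (((Γ₀ ++ Γ₁) ⊢ (Δ₀ ++ Δ₁)) ∷ G) →
           GŁ P ((Γ₀ ⊢ Δ₀) ∷ (Γ₁ ⊢ Δ₁) ∷ G)
  mix    : ∀ {Γ₀ Γ₁ Δ₀ Δ₁ G} →
           GŁ P ((Γ₀ ⊢ Δ₀) ∷ G) → GŁ P ((Γ₁ ⊢ Δ₁) ∷ G) →
           GŁ P (((Γ₀ ++ Γ₁) ⊢ (Δ₀ ++ Δ₁)) ∷ G)
  wl     : ∀ {Γ Δ G} A → GŁ P ((Γ ⊢ Δ) ∷ G) → GŁ P (((A ∷ Γ) ⊢ Δ) ∷ G)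
  →l     : ∀ {Γ Δ G} A B →
           GŁ P (((B ∷ Γ) ⊢ (A ∷ Δ)) ∷ (Γ ⊢ Δ) ∷ G) →
           GŁ P ((((A ⇒ B) ∷ Γ) ⊢ Δ) ∷ G)
  →r     : ∀ {Γ Δ G} A B →
           GŁ P (((A ∷ Γ) ⊢ (B ∷ Δ)) ∷ G) → GŁ P ((Γ ⊢ Δ) ∷ G) →
           GŁ P ((Γ ⊢ ((A ⇒ B) ∷ Δ)) ∷ G)

rep : {X : Set} → ℕ → List X → List X
rep zero    Γ = []
rep (suc n) Γ = Γ ++ rep n Γ

_⊢[1/_]_ : {At : Set} → List (Fm At) → ℕ → List (Fm At) → Seq At
Γ ⊢[1/ n ] Δ = (⊥' ∷ rep n Γ) ⊢ rep n Δ

infix 20 _⊢[1/_]_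

{-# OPTIONS --safe #-}
-- Both rules are the case k = n of rules introducing k copies of A → B at once,
-- proved by induction on k. On the left the hypotheses of the k-fold rule are then
-- exactly the premise. On the right, n applications of (⇒→) leave the sequents
-- jA, ⊥, nΓ ⇒ jB, nΔ for all j ≤ n. Mixing j copies of the first premise with
-- n − j copies of the second yields n copies of such a sequent, as an identity
-- between multiples in a commutative monoid; split and ec reduce them to one.
module Submission where

open import Defs
open import Algebra.Bundles using (CommutativeMonoid)
open import Data.Nat using (ℕ; zero; suc; _+_; _*_; _≤_; z≤n; s≤s)
open import Data.Nat.Properties using (*-comm; m≤n⇒m≤1+n; m≤n⇒∃[o]m+o≡n)
open import Data.List using (List; []; _∷_; _++_; [_])
open import Data.List.Properties using (++-identityʳ)
open import Data.List.Relation.Unary.Any using (here; there)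
open import Data.List.Relation.Binary.Permutation.Propositional
  using (_↭_; ↭-refl; ↭-prep; ↭-sym; ↭-trans; ↭-reflexive)
open import Data.List.Relation.Binary.Permutation.Propositional.Properties
  using (shift; ++-commutativeMonoid)
open import Data.Product using (_×_; _,_)
open import Relation.Binary.PropositionalEquality using (_≡_; refl; cong)

module _ {c ℓ} (M : CommutativeMonoid c ℓ) where
  open CommutativeMonoid M
  open import Algebra.Properties.CommutativeMonoid.Mult M renaming (_×_ to _·_)
  open import Algebra.Properties.CommutativeSemigroup commutativeSemigroup using (x∙yz≈y∙xz)
  open import Relation.Binary.Reasoning.Setoid setoid

  ·-comm : ∀ x m n → m · (n · x) ≈ n · (m · x)
  ·-comm x m n = begin
    m · (n · x)  ≈⟨ ×-assocˡ x m n ⟩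
    (m * n) · x  ≈⟨ ×-congˡ (*-comm m n) ⟩
    (n * m) · x  ≈⟨ ×-assocˡ x n m ⟨
    n · (m · x)  ∎

  ·-interpolate : ∀ j m f a g → let n = j + m ; t = f ∙ n · g in
                  j · (f ∙ n · (a ∙ g)) ∙ m · t ≈ n · (j · a ∙ t)
  ·-interpolate j m f a g = begin
    j · (f ∙ n · (a ∙ g)) ∙ m · t      ≈⟨ ∙-congʳ (×-congʳ j (∙-congˡ (×-distrib-+ a g n))) ⟩
    j · (f ∙ (n · a ∙ n · g)) ∙ m · t  ≈⟨ ∙-congʳ (×-congʳ j (x∙yz≈y∙xz f (n · a) (n · g))) ⟩
    j · (n · a ∙ t) ∙ m · t            ≈⟨ ∙-congʳ (×-distrib-+ (n · a) t j) ⟩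
    (j · (n · a) ∙ j · t) ∙ m · t      ≈⟨ assoc _ _ _ ⟩
    j · (n · a) ∙ (j · t ∙ m · t)      ≈⟨ ∙-cong (·-comm a n j) (×-homo-+ t j m) ⟨
    n · (j · a) ∙ n · t                ≈⟨ ×-distrib-+ (j · a) t n ⟨
    n · (j · a ∙ t)                    ∎
    where
    n : ℕ
    n = j + m
    t : Carrier
    t = f ∙ n · g

module _ {X : Set} where
  open import Algebra.Properties.CommutativeMonoid.Mult (++-commutativeMonoid {A = X})
    using (×-distrib-+) renaming (_×_ to _·_)

  rep≡· : ∀ n (xs : List X) → rep n xs ≡ n · xs
  rep≡· zero    xs = refl
  rep≡· (suc n) xs = cong (xs ++_) (rep≡· n xs)

  rep-∷ : ∀ n (x : X) xs → rep n (x ∷ xs) ↭ rep n [ x ] ++ rep n xs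
  rep-∷ n x xs rewrite rep≡· n (x ∷ xs) | rep≡· n [ x ] | rep≡· n xs = ×-distrib-+ [ x ] xs n

  rep-∷-shift : ∀ n (y x : X) xs → y ∷ rep n (x ∷ xs) ↭ rep n [ x ] ++ y ∷ rep n xs
  rep-∷-shift n y x xs = ↭-trans (↭-prep y (rep-∷ n x xs)) (↭-sym (shift y (rep n [ x ]) (rep n xs)))

  rep-interpolate : ∀ j m (f a g : List X) → let n = j + m in
                    rep j (f ++ rep n (a ++ g)) ++ rep m (f ++ rep n g) ↭ rep n (rep j a ++ (f ++ rep n g))
  rep-interpolate j m f a g
    rewrite rep≡· (j + m) (a ++ g) | rep≡· (j + m) g | rep≡· j a
          | rep≡· j (f ++ (j + m) · (a ++ g)) | rep≡· m (f ++ (j + m) · g)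
          | rep≡· (j + m) (j · a ++ (f ++ (j + m) · g))
          = ·-interpolate ++-commutativeMonoid j m f a g

module _ {At : Set} {P : List (Hyp At)} where

  exH-shift : ∀ {S} Ts {H} → GŁ P (S ∷ Ts ++ H) → GŁ P (Ts ++ S ∷ H)
  exH-shift {S} Ts {H} = exH (↭-sym (shift S Ts H))

  ew⁺ : ∀ {S} G → GŁ P (S ∷ []) → GŁ P (S ∷ G)
  ew⁺ []      d = d
  ew⁺ (_ ∷ G) d = ew (ew⁺ G d)

  mix-rep : ∀ k {X Y G} → GŁ P ((X ⊢ Y) ∷ G) → GŁ P ((rep k X ⊢ rep k Y) ∷ G)
  mix-rep zero    {G = G} _ = ew⁺ G empty
  mix-rep (suc k) d = mix d (mix-rep k d)

  contract-rep : ∀ k {X Y G} → GŁ P ((rep (suc k) X ⊢ rep (suc k) Y) ∷ G) → GŁ P ((X ⊢ Y) ∷ G)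
  contract-rep zero {X} {Y} d = exS (↭-reflexive (++-identityʳ X)) (↭-reflexive (++-identityʳ Y)) d
  contract-rep (suc k) d = ec (contract-rep k (exH-shift [ _ ] (split d)))

  module _ (A B : Fm At) where

    →l-rep : ∀ k {X Y H} →
             GŁ P (((rep k [ B ] ++ X) ⊢ (rep k [ A ] ++ Y)) ∷ (X ⊢ Y) ∷ H) →
             GŁ P (((rep k [ A ⇒ B ] ++ X) ⊢ Y) ∷ H)
    →l-rep zero    d = ec d
    -- The induction hypothesis is used twice: with B, X ⊢ A, Y in place of X ⊢ Y for the
    -- component B, (A → B)^k, X ⊢ A, Y of the premise of (→l), then for (A → B)^k, X ⊢ Y.
    →l-rep (suc k) {X} {Y} {H} d = →l A B (exH-shift [ _ ] (→l-rep k (exH-shift (_ ∷ _ ∷ []) B⊢A)))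
      where
      B⊢A : GŁ P (((B ∷ rep k [ A ⇒ B ] ++ X) ⊢ (A ∷ Y)) ∷
                  ((rep k [ B ] ++ X) ⊢ (rep k [ A ] ++ Y)) ∷ (X ⊢ Y) ∷ H)
      B⊢A = exS (shift B _ X) ↭-refl
                (→l-rep k (exS (↭-sym (shift B _ X)) (↭-sym (shift A _ Y)) (ew (ew d))))

    →r-rep : ∀ k {X Y H} →
             (∀ j → j ≤ k → GŁ P (((rep j [ A ] ++ X) ⊢ (rep j [ B ] ++ Y)) ∷ H)) →
             GŁ P ((X ⊢ (rep k [ A ⇒ B ] ++ Y)) ∷ H)
    →r-rep zero    ds = ds zero z≤n
    →r-rep (suc k) {X} {Y} {H} ds =
      →r A B (exS ↭-refl (shift B _ Y) (→r-rep k ds⁺)) (→r-rep k λ j j≤k → ds j (m≤n⇒m≤1+n j≤k))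
      where
      ds⁺ : ∀ j → j ≤ k → GŁ P (((rep j [ A ] ++ A ∷ X) ⊢ (rep j [ B ] ++ B ∷ Y)) ∷ H)
      ds⁺ j j≤k = exS (↭-sym (shift A _ X)) (↭-sym (shift B _ Y)) (ds (suc j) (s≤s j≤k))

    interpolate : ∀ {n j Γ Δ G} → j ≤ n →
                  GŁ P (((A ∷ Γ) ⊢[1/ n ] (B ∷ Δ)) ∷ G) → GŁ P ((Γ ⊢[1/ n ] Δ) ∷ G) →
                  GŁ P (((rep j [ A ] ++ ⊥' ∷ rep n Γ) ⊢ (rep j [ B ] ++ rep n Δ)) ∷ G)
    interpolate {j = zero} _ _ d₀ = d₀
    interpolate {j = suc j} {Γ} {Δ} 1+j≤n d₁ d₀ with m≤n⇒∃[o]m+o≡n 1+j≤n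
    ... | m , refl =
      contract-rep (j + m)
        (exS (rep-interpolate (suc j) m [ ⊥' ] [ A ] Γ) (rep-interpolate (suc j) m [] [ B ] Δ)
          (mix (mix-rep (suc j) d₁) (mix-rep m d₀)))

    →l[1/n] : ∀ n {Γ Δ G} →
              GŁ P (((B ∷ Γ) ⊢[1/ n ] (A ∷ Δ)) ∷ (Γ ⊢[1/ n ] Δ) ∷ G) →
              GŁ P ((((A ⇒ B) ∷ Γ) ⊢[1/ n ] Δ) ∷ G)
    →l[1/n] n {Γ} {Δ} d =
      exS (↭-sym (rep-∷-shift n ⊥' (A ⇒ B) Γ)) ↭-refl
        (→l-rep n (exS (rep-∷-shift n ⊥' B Γ) (rep-∷ n A Δ) d))

    →r[1/n] : ∀ n {Γ Δ G} →
              GŁ P (((A ∷ Γ) ⊢[1/ n ] (B ∷ Δ)) ∷ G) → GŁ P ((Γ ⊢[1/ n ] Δ) ∷ G) →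
              GŁ P ((Γ ⊢[1/ n ] ((A ⇒ B) ∷ Δ)) ∷ G)
    →r[1/n] n {Δ = Δ} d₁ d₀ =
      exS ↭-refl (↭-sym (rep-∷ n (A ⇒ B) Δ)) (→r-rep n λ j j≤n → interpolate j≤n d₁ d₀)

mainTheorem8 : {At : Set} (n : ℕ) (G : Hyp At) (Γ Δ : List (Fm At)) (A B : Fm At) →
    GŁ ((((B ∷ Γ) ⊢[1/ n ] (A ∷ Δ)) ∷ (Γ ⊢[1/ n ] Δ) ∷ G) ∷ [])
       ((((A ⇒ B) ∷ Γ) ⊢[1/ n ] Δ) ∷ G)
    × GŁ ((((A ∷ Γ) ⊢[1/ n ] (B ∷ Δ)) ∷ G) ∷ ((Γ ⊢[1/ n ] Δ) ∷ G) ∷ [])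
         ((Γ ⊢[1/ n ] ((A ⇒ B) ∷ Δ)) ∷ G)
mainTheorem8 n G Γ Δ A B =
    →l[1/n] A B n (hyp (here refl))
  , →r[1/n] A B n (hyp (here refl)) (hyp (there (here refl)))
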